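{- Let $T$ be a balanced tree with a proper 2-coloring into red and blue in which all leaves are blue, and suppose $\mathrm{height}(T)\ge 4$. Then $T$ has two minimal red-dominating sets of different sizes, and $T$ is not well-totally dominated.
   Context: All graphs are finite and simple. $N(v)$ is the open neighborhood of $v$ and $N(S)=\bigcup_{v\in S}N(v)$. A leaf is a vertex of degree 1; the height of a vertex is its minimum distance to a leaf; $\mathrm{height}(T)$ is the maximum height of a vertex. A tree is balanced if no two vertices of the same height are adjacent. A proper 2-coloring colors adjacent vertices differently; $V_\mathcal{R}$ denotes the set of red vertices. A red-dominating set (RDS) is a set $D$ with $N(D)=V_\mathcal{R}$; it is a minimal RDS if there is no proper subset $D'\subsetneq D$ with $N(D')=N(D)$. A total dominating set is a set $S$ with $N(S)=V(T)$, and $T$ is well-totally dominated if all its inclusion-minimal total dominating sets have the same size. -}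

module Defs where

open import Data.Nat using (ℕ; zero; suc; _≤_)
open import Data.Bool using (Bool; true; false; T)
open import Data.Bool.Properties using (T?)
open import Data.Fin using (Fin)
open import Data.Fin.Subset using (Subset; _∈_; _⊂_; ∣_∣)
open import Data.List using (List; []; _∷_; length; filter; allFin)
open import Data.List.Relation.Unary.Unique.Propositional using (Unique)
open import Data.Product using (Σ; ∃; ∃-syntax; _×_; _,_)
open import Relation.Binary.PropositionalEquality using (_≡_; _≢_)
open import Relation.Nullary using (¬_)
open import Data.Empty using (⊥)
open import Function.Bundles using (_⇔_)

record Graph : Set where
  field
    n     : ℕ
    adj   : Fin n → Fin n → Bool
    sym   : ∀ u v → adj u v ≡ adj v u
    irrefl : ∀ v → adj v v ≡ false

open Graph public

module _ (G : Graph) where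

  Vertex : Set
  Vertex = Fin (n G)

  Adj : Vertex → Vertex → Set
  Adj u v = adj G u v ≡ true

  data Walk : Vertex → Vertex → ℕ → Set where
    here : ∀ {u} → Walk u u 0
    step : ∀ {u w v k} → Adj u w → Walk w v k → Walk u v (suc k)

  Connected : Set
  Connected = ∀ u v → ∃[ k ] Walk u v k

  data Chain : List Vertex → Set where
    nil  : Chain []
    one  : ∀ {v} → Chain (v ∷ [])
    cons : ∀ {u v vs} → Adj u v → Chain (v ∷ vs) → Chain (u ∷ v ∷ vs)

  Cycle : List Vertex → Set
  Cycle [] = ⊥
  Cycle (v₀ ∷ rest) =
    Unique (v₀ ∷ rest) × Chain (v₀ ∷ rest) × 3 ≤ length (v₀ ∷ rest)
    × Σ Vertex (λ vk → Last (v₀ ∷ rest) vk × Adj vk v₀)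
    where
      Last : List Vertex → Vertex → Set
      Last [] _ = ⊥
      Last (x ∷ []) y = x ≡ y
      Last (_ ∷ x ∷ xs) y = Last (x ∷ xs) y

  Acyclic : Set
  Acyclic = ∀ cs → ¬ Cycle cs

  IsTree : Set
  IsTree = Connected × Acyclic

  degree : Vertex → ℕ
  degree v = length (filter (λ w → T? (adj G v w)) (allFin (n G)))

  Leaf : Vertex → Set
  Leaf v = degree v ≡ 1

  HeightIs : Vertex → ℕ → Set
  HeightIs v h = (∃[ l ] (Leaf l × Walk v l h))
               × (∀ l k → Leaf l → Walk v l k → h ≤ k)

  -- height(T) ≥ m  (height(T) is the maximum height of a vertex)
  HeightAtLeast : ℕ → Set
  HeightAtLeast m = ∃[ v ] ∃[ h ] (HeightIs v h × m ≤ h)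

  Balanced : Set
  Balanced = ∀ u v h → Adj u v → HeightIs u h → ¬ HeightIs v h

  -- red : the colouring (true = red, false = blue)
  ProperColoring : (Vertex → Bool) → Set
  ProperColoring red = ∀ u v → Adj u v → red u ≢ red v

  LeavesBlue : (Vertex → Bool) → Set
  LeavesBlue red = ∀ v → Leaf v → red v ≡ false

  InN : Subset (n G) → Vertex → Set
  InN D v = ∃[ u ] (u ∈ D × Adj u v)

  SameN : Subset (n G) → Subset (n G) → Set
  SameN D D' = ∀ v → InN D v ⇔ InN D' v

  IsRDS : (Vertex → Bool) → Subset (n G) → Set
  IsRDS red D = ∀ v → InN D v ⇔ (red v ≡ true)

  IsMinimalRDS : (Vertex → Bool) → Subset (n G) → Set
  IsMinimalRDS red D = IsRDS red D × (∀ D' → D' ⊂ D → ¬ SameN D' D)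

  IsTDS : Subset (n G) → Set
  IsTDS S = ∀ v → InN S v

  IsMinimalTDS : Subset (n G) → Set
  IsMinimalTDS S = IsTDS S × (∀ S' → S' ⊂ S → ¬ IsTDS S')

  WellTotallyDominated : Set
  WellTotallyDominated = ∀ S S' → IsMinimalTDS S → IsMinimalTDS S' → ∣ S ∣ ≡ ∣ S' ∣

{-# OPTIONS --safe #-}
module Submission where

-- Walking from a vertex of height at least 4 towards its nearest leaf, the last five vertices form a path
-- w₄ – w₃ – ρ – w₁ – w₀ in which w₀ is a leaf and no leaf lies within distance 2 of w₄. Root the tree at ρ,
-- which is blue, so that the blue vertices are those of even depth. The blue non-root vertices, except the
-- children of w₁ and w₃ other than w₀ and w₄ and the vertices four levels below w₄, dominate every red
-- vertex; pruning redundant vertices while keeping w₀, w₄ and the grandchildren of w₄ gives an irredundant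
-- red-dominating set DB. Replacing by ρ those vertices of DB whose private neighbours are all adjacent to ρ
-- gives a second one, DA. Both w₀ and w₄ are replaced, so |DA| < |DB|. Irredundant red-dominating sets of
-- blue vertices are minimal, and adding a fixed irredundant set of red vertices dominating the blue ones
-- turns DA and DB into minimal total dominating sets of different sizes.

open import Defs hiding (sym)
open import Data.Bool using (Bool; true; false; not)
import Data.Bool as Bool
open import Data.Bool.Properties using (¬-not; not-involutive; T?; T-≡)
open import Data.Fin using (Fin)
import Data.Fin.Properties as Fin
open import Data.Fin.Subset using (Subset; _∈_; _∉_; _⊆_; _⊂_; _∪_; _∩_; _-_; ⁅_⁆; ∣_∣; ⊥; inside; outside)
open import Data.Fin.Subset.Induction using (⊂-wellFounded)
open import Data.Fin.Subset.Properties
  using ( _∈?_; x∈p∪q⁻; x∈p∪q⁺; x∈p∩q⁻; x∈p∩q⁺; p∩q⊆p; x∈⁅x⁆; x∈⁅y⁆⇒x≡y; ∣⁅x⁆∣≡1; ∉⊥; ⊥⊆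
        ; x∈p∧x≢y⇒x∈p-y; x∈p⇒p-x⊂p; x∈p⇒∣p-x∣<∣p∣; p⊆q⇒∣p∣≤∣q∣; p─q⊆p)
open import Data.List using (List; []; _∷_; _∷ʳ_; length; filter; allFin)
open import Data.List.Membership.Propositional using () renaming (_∈_ to _∈ₗ_)
open import Data.List.Membership.Propositional.Properties using (∈-filter⁺; ∈-filter⁻; ∈-allFin)
open import Data.List.Relation.Unary.All using (All; []; _∷_)
import Data.List.Relation.Unary.All as All
open import Data.List.Relation.Unary.All.Properties using (∷ʳ⁺)
open import Data.List.Relation.Unary.AllPairs using ([]; _∷_)
open import Data.List.Relation.Unary.Any using (here; there)
open import Data.List.Relation.Unary.Unique.Propositional using (Unique)
import Data.List.Relation.Unary.Unique.Propositional.Properties as Unique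
open import Data.Nat using (ℕ; zero; suc; _+_; _∸_; _≤_; _<_; s≤s; s≤s⁻¹; z≤n)
import Data.Nat as ℕ
open import Data.Nat.GeneralisedArithmetic using (fold)
open import Data.Nat.Induction using (<-rec)
open import Data.Nat.Properties
  using ( anyUpTo?; ≮⇒≥; +-suc; ≤-<-trans; <-≤-trans; ≤-antisym; ≤-reflexive; <-cmp; <-irrefl; n<1+n
        ; suc-injective; n≤0⇒n≡0; m<n⇒m<1+n; +-cancelʳ-≡; +-cancelˡ-≤; m∸n+n≡m; <⇒≢)
open import Data.Product using (∃; ∃-syntax; _×_; _,_; proj₁; proj₂)
open import Data.Sum using (_⊎_; inj₁; inj₂)
open import Data.Vec using ([]; _∷_; here; there)
import Data.Vec as Vec
import Data.Vec.Properties as Vec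
open import Function.Base using (_∘_)
open import Function.Bundles using (mk⇔; Equivalence)
import Function.Properties.Equivalence as ⇔
open import Induction.WellFounded using (module All)
open import Level using (0ℓ)
open import Relation.Binary.Definitions using (tri<; tri≈; tri>)
open import Relation.Binary.PropositionalEquality using (_≡_; _≢_; refl; sym; trans; cong; subst)
open import Relation.Nullary using (¬_; Dec; yes; no; does; contradiction)
open import Relation.Nullary.Decidable using (map′; dec-true; _×-dec_; _⊎-dec_; _→-dec_; ¬?)
open import Relation.Unary using (Decidable)

least-ℕ : ∀ {P : ℕ → Set} → Decidable P → ∀ {K} → P K → ∃[ k ] P k × (∀ {i} → P i → k ≤ i)
least-ℕ {P} P? {K} = <-rec (λ K → P K → Least) search K
  where
  Least = ∃[ k ] P k × (∀ {i} → P i → k ≤ i)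
  search : ∀ K → (∀ {j} → j < K → P j → Least) → P K → Least
  search K smaller PK with anyUpTo? P? K
  ... | yes (j , j<K , Pj) = smaller j<K Pj
  ... | no none = K , PK , λ Pi → ≮⇒≥ (λ i<K → none (_ , i<K , Pi))

module _ {n : ℕ} where

  subsetOf : {P : Fin n → Set} → Decidable P → Subset n
  subsetOf P? = Vec.tabulate (λ x → does (P? x))

  ∈-subsetOf⁺ : {P : Fin n → Set} (P? : Decidable P) → ∀ {x} → P x → x ∈ subsetOf P?
  ∈-subsetOf⁺ P? {x} px = Vec.lookup⇒[]= x _ (trans (Vec.lookup∘tabulate _ x) (dec-true (P? x) px))

  ∈-subsetOf⁻ : {P : Fin n → Set} (P? : Decidable P) → ∀ {x} → x ∈ subsetOf P? → P x
  ∈-subsetOf⁻ P? {x} x∈ with P? x | trans (sym (Vec.lookup∘tabulate (λ x → does (P? x)) x)) (Vec.[]=⇒lookup x∈)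
  ... | yes px | _ = px
  ... | no _ | ()

private
  drop-disjoint : ∀ {n s t} {p q : Subset n} → (∀ {x} → x ∈ s ∷ p → x ∉ t ∷ q) → ∀ {x} → x ∈ p → x ∉ q
  drop-disjoint disjoint x∈p x∈q = disjoint (there x∈p) (there x∈q)

∣p∪q∣≡∣p∣+∣q∣ : ∀ {n} (p q : Subset n) → (∀ {x} → x ∈ p → x ∉ q) → ∣ p ∪ q ∣ ≡ ∣ p ∣ + ∣ q ∣
∣p∪q∣≡∣p∣+∣q∣ [] [] _ = refl
∣p∪q∣≡∣p∣+∣q∣ (inside ∷ p) (inside ∷ q) disjoint = contradiction here (disjoint here)
∣p∪q∣≡∣p∣+∣q∣ (inside ∷ p) (outside ∷ q) disjoint = cong suc (∣p∪q∣≡∣p∣+∣q∣ p q (drop-disjoint disjoint))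
∣p∪q∣≡∣p∣+∣q∣ (outside ∷ p) (inside ∷ q) disjoint =
  trans (cong suc (∣p∪q∣≡∣p∣+∣q∣ p q (drop-disjoint disjoint))) (sym (+-suc _ _))
∣p∪q∣≡∣p∣+∣q∣ (outside ∷ p) (outside ∷ q) disjoint = ∣p∪q∣≡∣p∣+∣q∣ p q (drop-disjoint disjoint)

1+∣q∣<∣p∣ : ∀ {n} {p q : Subset n} {x y} → q ⊆ p → x ∈ p → y ∈ p → x ≢ y → x ∉ q → y ∉ q → suc ∣ q ∣ < ∣ p ∣
1+∣q∣<∣p∣ {p = p} {q} {x} {y} q⊆p x∈p y∈p x≢y x∉q y∉q = ≤-<-trans ∣q∣<∣p-x∣ (x∈p⇒∣p-x∣<∣p∣ x∈p)
  where
  q⊆p-x-y : q ⊆ p - x - y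
  q⊆p-x-y z∈q = x∈p∧x≢y⇒x∈p-y (x∈p∧x≢y⇒x∈p-y (q⊆p z∈q) λ { refl → x∉q z∈q }) λ { refl → y∉q z∈q }
  ∣q∣<∣p-x∣ : ∣ q ∣ < ∣ p - x ∣
  ∣q∣<∣p-x∣ = ≤-<-trans (p⊆q⇒∣p∣≤∣q∣ q⊆p-x-y) (x∈p⇒∣p-x∣<∣p∣ (x∈p∧x≢y⇒x∈p-y y∈p (λ e → x≢y (sym e))))

unique-∷ʳ : ∀ {A : Set} {xs : List A} {y} → Unique xs → All (_≢ y) xs → Unique (xs ∷ʳ y)
unique-∷ʳ [] [] = [] ∷ []
unique-∷ʳ (x∉xs ∷ xs-unique) (x≢y ∷ xs≢y) = ∷ʳ⁺ x∉xs x≢y ∷ unique-∷ʳ xs-unique xs≢y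

module GraphTheory (G : Graph) where

  private
    V = Vertex G
    N = n G

  Adj? : ∀ u v → Dec (Adj G u v)
  Adj? u v = adj G u v Bool.≟ true

  Adj-sym : ∀ {u v} → Adj G u v → Adj G v u
  Adj-sym {u} {v} = trans (Graph.sym G v u)

  walk-++ : ∀ {u w v k m} → Walk G u w k → Walk G w v m → Walk G u v (k + m)
  walk-++ here q = q
  walk-++ (step a p) q = step a (walk-++ p q)

  walk-split : ∀ k {m u v} → Walk G u v (k + m) → ∃[ w ] Walk G u w k × Walk G w v m
  walk-split zero p = _ , here , p
  walk-split (suc k) (step a p) with walk-split k p
  ... | w , p₁ , p₂ = w , step a p₁ , p₂

  private
    neighbours : V → List V
    neighbours v = filter (λ w → T? (adj G v w)) (allFin N)

    ∈-neighbours : ∀ {v w} → Adj G v w → w ∈ₗ neighbours v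
    ∈-neighbours {v} {w} v~w =
      ∈-filter⁺ (λ w → T? (adj G v w)) (∈-allFin w) (Equivalence.from T-≡ v~w)

    neighbours-adj : ∀ {v w} → w ∈ₗ neighbours v → Adj G v w
    neighbours-adj {v} w∈ = Equivalence.to T-≡ (proj₂ (∈-filter⁻ (λ w → T? (adj G v w)) {xs = allFin N} w∈))

  leaf-neighbour-unique : ∀ {v a b} → Leaf G v → Adj G v a → Adj G v b → a ≡ b
  leaf-neighbour-unique leaf v~a v~b = singleton (neighbours _) leaf (∈-neighbours v~a) (∈-neighbours v~b)
    where
    singleton : ∀ (xs : List V) {a b} → length xs ≡ 1 → a ∈ₗ xs → b ∈ₗ xs → a ≡ b
    singleton (_ ∷ []) _ (here refl) (here refl) = refl

  neighbour-unique⇒Leaf : ∀ {v p} → Adj G v p → (∀ {y} → Adj G v y → y ≡ p) → Leaf G v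
  neighbour-unique⇒Leaf {v} v~p unique =
    singleton (Unique.filter⁺ (λ w → T? (adj G v w)) (Unique.allFin⁺ N)) (∈-neighbours v~p)
              (λ y∈ → unique (neighbours-adj y∈))
    where
    singleton : ∀ {xs : List V} {p} → Unique xs → p ∈ₗ xs → (∀ {y} → y ∈ₗ xs → y ≡ p) → length xs ≡ 1
    singleton {_ ∷ []} _ _ _ = refl
    singleton {x ∷ y ∷ _} ((x≢y ∷ _) ∷ _) _ all≡p =
      contradiction (trans (all≡p (here refl)) (sym (all≡p (there (here refl))))) x≢y

  -- `Cycle` in Defs closes up through a `Last` local to its where-block. `LastOf` is that family,
  -- recovered by unification once the `with` in `cycle-intro` turns the cycle into a variable.
  mutual
    LastOf : V → List V → List V → V → Set
    LastOf = _

    cycle-intro : ∀ v₀ rest vₖ → Unique (v₀ ∷ rest) → Chain G (v₀ ∷ rest) → 3 ≤ length (v₀ ∷ rest)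
                → LastOf v₀ rest (v₀ ∷ rest) vₖ → Adj G vₖ v₀ → Cycle G (v₀ ∷ rest)
    cycle-intro v₀ rest vₖ u c len l a with v₀ ∷ rest | u | c | len | l
    ... | _ | u′ | c′ | len′ | l′ = u′ , c′ , len′ , vₖ , l′ , a

  LastOf-∷ʳ : ∀ v₀ rest xs y → LastOf v₀ rest (xs ∷ʳ y) y
  LastOf-∷ʳ v₀ rest [] y = refl
  LastOf-∷ʳ v₀ rest (x ∷ []) y = refl
  LastOf-∷ʳ v₀ rest (x ∷ x′ ∷ xs) y = LastOf-∷ʳ v₀ rest (x′ ∷ xs) y

  chain-∷ʳ : ∀ {xs u y} → Chain G (xs ∷ʳ u) → Adj G u y → Chain G (xs ∷ʳ u ∷ʳ y)
  chain-∷ʳ {[]} one u~y = cons u~y one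
  chain-∷ʳ {x ∷ []} (cons x~u one) u~y = cons x~u (cons u~y one)
  chain-∷ʳ {x ∷ x′ ∷ xs} (cons x~x′ c) u~y = cons x~x′ (chain-∷ʳ {x′ ∷ xs} c u~y)

  cycle-∷ʳ : ∀ x y xs z → Unique (x ∷ y ∷ xs ∷ʳ z) → Chain G (x ∷ y ∷ xs ∷ʳ z) → Adj G z x
           → Cycle G (x ∷ y ∷ xs ∷ʳ z)
  cycle-∷ʳ x y xs z u c z~x =
    cycle-intro x (y ∷ xs ∷ʳ z) z u c (s≤s (s≤s (nonempty xs))) (LastOf-∷ʳ x (y ∷ xs ∷ʳ z) (x ∷ y ∷ xs) z) z~x
    where
    nonempty : ∀ xs → 1 ≤ length (xs ∷ʳ z)
    nonempty [] = s≤s z≤n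
    nonempty (_ ∷ _) = s≤s z≤n

  Private : Subset N → V → V → Set
  Private D u v = Adj G u v × (∀ u′ → u′ ∈ D → Adj G u′ v → u′ ≡ u)

  Private? : ∀ D u v → Dec (Private D u v)
  Private? D u v = Adj? u v ×-dec Fin.all? (λ u′ → (u′ ∈? D) →-dec (Adj? u′ v →-dec (u′ Fin.≟ u)))

  Irredundant : Subset N → Set
  Irredundant D = ∀ {u} → u ∈ D → ∃ (Private D u)

  private-transfer : ∀ {D S u v} → Private D u v → (∀ {u′} → u′ ∈ S → Adj G u′ v → u′ ∈ D) → Private S u v
  private-transfer (u~v , only-u) S~v⊆D = u~v , λ u′ u′∈S u′~v → only-u u′ (S~v⊆D u′∈S u′~v) u′~v

  rival : ∀ {D u v} → Adj G u v → ¬ Private D u v → ∃[ u′ ] u′ ∈ D × Adj G u′ v × u′ ≢ u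
  rival {D} {u} {v} u~v not-private
    with Fin.¬∀⟶∃¬ N _ (λ u′ → (u′ ∈? D) →-dec (Adj? u′ v →-dec (u′ Fin.≟ u)))
                       (λ only-u → not-private (u~v , only-u))
  ... | u′ , not-u with u′ ∈? D | Adj? u′ v | u′ Fin.≟ u
  ...   | yes u′∈D | yes u′~v | no u′≢u = u′ , u′∈D , u′~v , u′≢u
  ...   | yes _ | yes _ | yes u′≡u = contradiction (λ _ _ → u′≡u) not-u
  ...   | yes _ | no ¬u′~v | _ = contradiction (λ _ u′~v → contradiction u′~v ¬u′~v) not-u
  ...   | no u′∉D | _ | _ = contradiction (λ u′∈D → contradiction u′∈D u′∉D) not-u

  irredundant-strict : ∀ {D D′} → Irredundant D → D′ ⊂ D → ∃[ v ] InN G D v × ¬ InN G D′ v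
  irredundant-strict irr (D′⊆D , x , x∈D , x∉D′) with irr x∈D
  ... | v , x~v , only-x =
    v , (x , x∈D , x~v) , λ { (u , u∈D′ , u~v) → x∉D′ (subst (_∈ _) (only-x u (D′⊆D u∈D′) u~v) u∈D′) }

  redundant-removable : ∀ {D u} → u ∈ D → (∀ v → ¬ Private D u v) → SameN G (D - u) D
  redundant-removable {D} {u} u∈D redundant v = mk⇔ widen narrow
    where
    widen : InN G (D - u) v → InN G D v
    widen (w , w∈ , w~v) = w , p─q⊆p D ⁅ u ⁆ w∈ , w~v
    narrow : InN G D v → InN G (D - u) v
    narrow (w , w∈D , w~v) with w Fin.≟ u
    ... | no w≢u = w , x∈p∧x≢y⇒x∈p-y w∈D w≢u , w~v
    ... | yes refl with rival w~v (redundant v)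
    ...   | u′ , u′∈D , u′~v , u′≢u = u′ , x∈p∧x≢y⇒x∈p-y u′∈D u′≢u , u′~v

  record Pruning (F D : Subset N) : Set where
    field
      pruned : Subset N
      keeps : F ⊆ pruned
      within : pruned ⊆ D
      same-neighbourhood : SameN G pruned D
      irredundant : Irredundant pruned

  -- Repeatedly discard a redundant vertex outside F; vertices of F keep their private neighbours.
  irredundant-core : ∀ F D → F ⊆ D → (∀ {u} → u ∈ F → ∃ (Private D u)) → Pruning F D
  irredundant-core F = All.wfRec ⊂-wellFounded 0ℓ Goal shrink
    where
    Goal : Subset N → Set
    Goal D = F ⊆ D → (∀ {u} → u ∈ F → ∃ (Private D u)) → Pruning F D
    shrink : ∀ D → (∀ {D′} → D′ ⊂ D → Goal D′) → Goal D
    shrink D smaller F⊆D F-private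
      with Fin.any? (λ u → (u ∈? D) ×-dec ¬? (u ∈? F) ×-dec ¬? (Fin.any? (Private? D u)))
    ... | yes (u , u∈D , u∉F , redundant) = record
          { pruned = pruned P
          ; keeps = keeps P
          ; within = p─q⊆p D ⁅ u ⁆ ∘ within P
          ; same-neighbourhood = λ v →
              ⇔.trans (same-neighbourhood P v) (redundant-removable u∈D (λ v p → redundant (v , p)) v)
          ; irredundant = irredundant P
          }
      where
      open Pruning
      P : Pruning F (D - u)
      P = smaller (x∈p⇒p-x⊂p u∈D)
            (λ x∈F → x∈p∧x≢y⇒x∈p-y (F⊆D x∈F) λ { refl → u∉F x∈F })
            (λ x∈F → let v , p = F-private x∈F in v , private-transfer p (λ u′∈ _ → p─q⊆p D ⁅ u ⁆ u′∈))
    ... | no none = record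
          { pruned = D ; keeps = F⊆D ; within = λ x → x ; same-neighbourhood = λ v → ⇔.refl ; irredundant = irr }
      where
      irr : Irredundant D
      irr {u} u∈D with u ∈? F | Fin.any? (Private? D u)
      ... | yes u∈F | _ = F-private u∈F
      ... | no _ | yes p = p
      ... | no u∉F | no np = contradiction (u , u∈D , u∉F , np) none

module Colouring (G : Graph) (red : Vertex G → Bool) (proper : ProperColoring G red) where
  open GraphTheory G

  colour-flip : ∀ {u v} → Adj G u v → red v ≡ not (red u)
  colour-flip {u} {v} u~v = ¬-not (proper v u (Adj-sym u~v))

  colour-walk : ∀ {x y k} → Walk G x y k → red x ≡ fold (red y) not k
  colour-walk here = refl
  colour-walk (step x~w p) = trans (colour-flip (Adj-sym x~w)) (cong not (colour-walk p))

  Cover : Bool → Subset (n G) → Set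
  Cover c D = (∀ {x} → x ∈ D → red x ≡ not c) × (∀ v → red v ≡ c → InN G D v) × Irredundant D

  Cover-private : ∀ {c D x} → Cover c D → x ∈ D → ∃[ v ] Private D x v × red v ≡ c
  Cover-private {c} (colour , _ , irr) x∈D with irr x∈D
  ... | v , x~v , only-x =
    v , (x~v , only-x) , trans (colour-flip x~v) (trans (cong not (colour x∈D)) (not-involutive c))

  Cover⇒MinimalRDS : ∀ {D} → Cover true D → IsMinimalRDS G red D
  Cover⇒MinimalRDS {D} (blue , dominating , irr) = (λ v → mk⇔ (neighbour-red v) (dominating v)) , minimal
    where
    neighbour-red : ∀ v → InN G D v → red v ≡ true
    neighbour-red v (u , u∈D , u~v) = trans (colour-flip u~v) (cong not (blue u∈D))
    minimal : ∀ D′ → D′ ⊂ D → ¬ SameN G D′ D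
    minimal D′ D′⊂D same with irredundant-strict irr D′⊂D
    ... | v , in-D , not-in-D′ = not-in-D′ (Equivalence.from (same v) in-D)

  Cover-∪-MinimalTDS : ∀ {D C} → Cover true D → Cover false C → IsMinimalTDS G (D ∪ C)
  Cover-∪-MinimalTDS {D} {C} coverD@(blue , dominate-red , _) coverC@(red′ , dominate-blue , _) = total , minimal
    where
    total : IsTDS G (D ∪ C)
    total v with red v Bool.≟ true
    ... | yes r = let u , u∈D , u~v = dominate-red v r in u , x∈p∪q⁺ (inj₁ u∈D) , u~v
    ... | no b = let u , u∈C , u~v = dominate-blue v (¬-not b) in u , x∈p∪q⁺ (inj₂ u∈C) , u~v
    irr : Irredundant (D ∪ C)
    irr x∈ with x∈p∪q⁻ D C x∈
    ... | inj₁ x∈D = let v , p , red-v = Cover-private coverD x∈D in v , private-transfer p (only-D red-v)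
      where
      only-D : ∀ {v} → red v ≡ true → ∀ {u} → u ∈ D ∪ C → Adj G u v → u ∈ D
      only-D red-v u∈ u~v with x∈p∪q⁻ D C u∈
      ... | inj₁ u∈D = u∈D
      ... | inj₂ u∈C = contradiction (trans (red′ u∈C) (sym red-v)) (proper _ _ u~v)
    ... | inj₂ x∈C = let v , p , blue-v = Cover-private coverC x∈C in v , private-transfer p (only-C blue-v)
      where
      only-C : ∀ {v} → red v ≡ false → ∀ {u} → u ∈ D ∪ C → Adj G u v → u ∈ C
      only-C blue-v u∈ u~v with x∈p∪q⁻ D C u∈
      ... | inj₁ u∈D = contradiction (trans (blue u∈D) (sym blue-v)) (proper _ _ u~v)
      ... | inj₂ u∈C = u∈C
    minimal : ∀ S′ → S′ ⊂ D ∪ C → ¬ IsTDS G S′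
    minimal S′ S′⊂S total′ with irredundant-strict irr S′⊂S
    ... | v , _ , not-in-S′ = not-in-S′ (total′ v)

  Cover-∪-size : ∀ {D C} → Cover true D → Cover false C → ∣ D ∪ C ∣ ≡ ∣ D ∣ ℕ.+ ∣ C ∣
  Cover-∪-size {D} {C} (blue , _ , _) (red′ , _ , _) =
    ∣p∪q∣≡∣p∣+∣q∣ D C (λ x∈D x∈C → contradiction (trans (sym (blue x∈D)) (red′ x∈C)) λ ())

  Cover-sizes⇒¬WellTotallyDominated : ∀ {D₁ D₂ C} → Cover true D₁ → Cover true D₂ → Cover false C
                                      → ∣ D₁ ∣ ≢ ∣ D₂ ∣ → ¬ WellTotallyDominated G
  Cover-sizes⇒¬WellTotallyDominated {D₁} {D₂} {C} cover₁ cover₂ coverC sizes wtd =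
    sizes (+-cancelʳ-≡ (∣ C ∣) (∣ D₁ ∣) (∣ D₂ ∣)
      (trans (sym (Cover-∪-size cover₁ coverC))
        (trans (wtd _ _ (Cover-∪-MinimalTDS cover₁ coverC) (Cover-∪-MinimalTDS cover₂ coverC))
          (Cover-∪-size cover₂ coverC))))

  private
    red? : ∀ x → Dec (red x ≡ true)
    red? x = red x Bool.≟ true

    reds : Subset (n G)
    reds = subsetOf red?

  blue-cover : (∀ v → ∃ (Adj G v)) → ∃ (Cover false)
  blue-cover no-isolated = pruned , (λ x∈C → ∈-subsetOf⁻ red? (within x∈C)) , dominating , irredundant
    where
    open Pruning (irredundant-core ⊥ reds ⊥⊆ (λ x∈⊥ → contradiction x∈⊥ ∉⊥))
    dominating : ∀ v → red v ≡ false → InN G pruned v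
    dominating v blue with no-isolated v
    ... | u , v~u = Equivalence.from (same-neighbourhood v)
                      (u , ∈-subsetOf⁺ red? (trans (colour-flip v~u) (cong not blue)) , Adj-sym v~u)

module RootedTree (G : Graph) (connected : Connected G) (acyclic : Acyclic G)
                  (red : Vertex G → Bool) (proper : ProperColoring G red) (ρ : Vertex G) where
  open GraphTheory G
  open Colouring G red proper

  private
    V = Vertex G

  Walk? : ∀ k x → Dec (Walk G x ρ k)
  Walk? zero x with x Fin.≟ ρ
  ... | yes refl = yes here
  ... | no x≢ρ = no λ { here → x≢ρ refl }
  Walk? (suc k) x with Fin.any? (λ w → Adj? x w ×-dec Walk? k w)
  ... | yes (w , x~w , w⇝ρ) = yes (step x~w w⇝ρ)
  ... | no none = no λ { (step x~w w⇝ρ) → none (_ , x~w , w⇝ρ) }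

  opaque
    depth : V → ℕ
    depth x = proj₁ (least-ℕ (λ k → Walk? k x) (proj₂ (connected x ρ)))

    depth-walk : ∀ x → Walk G x ρ (depth x)
    depth-walk x = proj₁ (proj₂ (least-ℕ (λ k → Walk? k x) (proj₂ (connected x ρ))))

    depth-least : ∀ {x k} → Walk G x ρ k → depth x ≤ k
    depth-least {x} = proj₂ (proj₂ (least-ℕ (λ k → Walk? k x) (proj₂ (connected x ρ))))

  depth-ρ : depth ρ ≡ 0
  depth-ρ = n≤0⇒n≡0 (depth-least here)

  depth≡0⇒ρ : ∀ {x} → depth x ≡ 0 → x ≡ ρ
  depth≡0⇒ρ {x} d≡0 with depth x | depth-walk x
  depth≡0⇒ρ refl | zero | here = refl

  depth-adj : ∀ {x y} → Adj G x y → depth x ≤ suc (depth y)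
  depth-adj x~y = depth-least (step x~y (depth-walk _))

  depth-colour : ∀ x → red x ≡ fold (red ρ) not (depth x)
  depth-colour x = colour-walk (depth-walk x)

  Child : V → V → Set
  Child p c = Adj G p c × depth c ≡ suc (depth p)

  Child? : ∀ p c → Dec (Child p c)
  Child? p c = Adj? p c ×-dec (depth c ℕ.≟ suc (depth p))

  Adj⇒Child : ∀ {x y} → Adj G x y → Child x y ⊎ Child y x
  Adj⇒Child {x} {y} x~y with <-cmp (depth x) (depth y)
  ... | tri< x<y _ _ = inj₁ (x~y , ≤-antisym (depth-adj (Adj-sym x~y)) x<y)
  ... | tri> _ _ y<x = inj₂ (Adj-sym x~y , ≤-antisym (depth-adj x~y) y<x)
  ... | tri≈ _ same _ =
    contradiction (trans (depth-colour x) (trans (cong (fold (red ρ) not) same) (sym (depth-colour y))))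
                  (proper x y x~y)

  ¬Child-ρ : ∀ {p} → ¬ Child p ρ
  ¬Child-ρ (_ , d) = contradiction (trans (sym d) depth-ρ) λ ()

  Child-≢ : ∀ {p c} → Child p c → c ≢ p
  Child-≢ (_ , d) refl = <-irrefl d (n<1+n _)

  parent : ∀ {x} → x ≢ ρ → ∃[ p ] Child p x
  parent {x} x≢ρ with depth x in eq | depth-walk x
  ... | zero | _ = contradiction (depth≡0⇒ρ eq) x≢ρ
  ... | suc k | step {w = w} x~w w⇝ρ = w , Adj-sym x~w , cong suc (sym depth-w)
    where
    depth-w : depth w ≡ k
    depth-w = ≤-antisym (depth-least w⇝ρ) (s≤s⁻¹ (subst (_≤ suc (depth w)) eq (depth-adj x~w)))

  private
    ≢ρ : ∀ {x k} → depth x ≡ suc k → x ≢ ρ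
    ≢ρ d refl = contradiction (trans (sym d) depth-ρ) λ ()

    record Bridge (k : ℕ) (a b : V) : Set where
      field
        inner   : List V
        chain   : Chain G (a ∷ inner ∷ʳ b)
        unique  : Unique (a ∷ inner ∷ʳ b)
        shallow : All (λ v → depth v < k) inner
    open Bridge

    shallow-≢ : ∀ {k y} {vs : List V} → All (λ v → depth v < k) vs → k ≤ depth y → All (y ≢_) vs
    shallow-≢ vs<k k≤y = All.map (λ v<k → λ { refl → <-irrefl refl (<-≤-trans v<k k≤y) }) vs<k

    bridge : ∀ k {a b} → depth a ≡ k → depth b ≡ k → a ≢ b → Bridge k a b
    bridge zero da db a≢b = contradiction (trans (depth≡0⇒ρ da) (sym (depth≡0⇒ρ db))) a≢b
    bridge (suc k) {a} {b} da db a≢b with parent (≢ρ da) | parent (≢ρ db)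
    ... | p , p~a , dp | q , q~b , dq with p Fin.≟ q
    ...   | yes refl = record
            { inner = p ∷ []
            ; chain = cons (Adj-sym p~a) (cons q~b one)
            ; unique = (Child-≢ (p~a , dp) ∷ a≢b ∷ []) ∷ ((λ p≡b → Child-≢ (q~b , dq) (sym p≡b)) ∷ []) ∷ [] ∷ []
            ; shallow = ≤-reflexive dp′ ∷ []
            }
      where
      dp′ : suc (depth p) ≡ suc k
      dp′ = trans (sym dp) da
    ...   | no p≢q = record
            { inner = p ∷ inner B ∷ʳ q
            ; chain = cons (Adj-sym p~a) (chain-∷ʳ {p ∷ inner B} (chain B) q~b)
            ; unique = ∷ʳ⁺ (shallow-≢ middle (≤-reflexive (sym da))) a≢b
                     ∷ unique-∷ʳ (unique B)
                                 (All.map (λ ne e → ne (sym e)) (shallow-≢ middle (≤-reflexive (sym db))))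
            ; shallow = middle
            }
      where
      dp′ : depth p ≡ k
      dp′ = suc-injective (trans (sym dp) da)
      dq′ : depth q ≡ k
      dq′ = suc-injective (trans (sym dq) db)
      B = bridge k dp′ dq′ p≢q
      middle : All (λ v → depth v < suc k) (p ∷ inner B ∷ʳ q)
      middle = ≤-reflexive (cong suc dp′) ∷ ∷ʳ⁺ (All.map m<n⇒m<1+n (shallow B)) (≤-reflexive (cong suc dq′))

  -- Two parents of x, joined by a bridge through smaller depths, would close a cycle through x.
  Child-unique : ∀ {a b x} → Child a x → Child b x → a ≡ b
  Child-unique {a} {b} {x} (a~x , dx) (b~x , dx′) with a Fin.≟ b
  ... | yes a≡b = a≡b
  ... | no a≢b =
    contradiction (cycle-∷ʳ x a (inner B) b (x-fresh ∷ unique B) (cons (Adj-sym a~x) (chain B)) b~x) (acyclic _)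
    where
    same : depth b ≡ depth a
    same = suc-injective (trans (sym dx′) dx)
    B = bridge (depth a) refl same a≢b
    x-fresh : All (x ≢_) (a ∷ inner B ∷ʳ b)
    x-fresh = shallow-≢ (n<1+n _ ∷ ∷ʳ⁺ (All.map m<n⇒m<1+n (shallow B)) (≤-reflexive (cong suc same)))
                        (≤-reflexive (sym dx))

  Adj-ρ⇒Child : ∀ {v} → Adj G ρ v → Child ρ v
  Adj-ρ⇒Child ρ~v with Adj⇒Child ρ~v
  ... | inj₁ c = c
  ... | inj₂ c = contradiction c ¬Child-ρ

  ¬Leaf⇒Child : ∀ {x} → x ≢ ρ → ¬ Leaf G x → ∃ (Child x)
  ¬Leaf⇒Child {x} x≢ρ not-leaf with Fin.any? (Child? x) | parent x≢ρ
  ... | yes c | _ = c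
  ... | no childless | p , p⋖x = contradiction (neighbour-unique⇒Leaf (Adj-sym (proj₁ p⋖x)) only-parent) not-leaf
    where
    only-parent : ∀ {y} → Adj G x y → y ≡ p
    only-parent x~y with Adj⇒Child x~y
    ... | inj₁ c = contradiction (_ , c) childless
    ... | inj₂ c = Child-unique c p⋖x

record Spine (T : Graph) : Set where
  field
    w₀ w₁ ρ w₃ w₄ : Vertex T
    w₁~w₀ : Adj T w₁ w₀
    ρ~w₁ : Adj T ρ w₁
    ρ~w₃ : Adj T ρ w₃
    w₃~w₄ : Adj T w₃ w₄
    w₀-leaf : Leaf T w₀
    no-leaf-near-w₄ : ∀ {r y} → Adj T w₄ r → Adj T r y → ¬ Leaf T y

-- Walk from a vertex of height h ≥ 4 towards its nearest leaf and stop four steps before it.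
spine : ∀ {T} → HeightAtLeast T 4 → Spine T
spine {T} (v , h , ((l , l-leaf , v⇝l) , nearest) , 4≤h)
  with GraphTheory.walk-split T (h ∸ 4) (subst (Walk T v l) (sym (m∸n+n≡m 4≤h)) v⇝l)
... | w₄ , v⇝w₄ , step {w = w₃} w₄~w₃ (step {w = ρ} w₃~ρ (step {w = w₁} ρ~w₁ (step w₁~l here))) = record
  { w₀ = l ; w₁ = w₁ ; ρ = ρ ; w₃ = w₃ ; w₄ = w₄
  ; w₁~w₀ = w₁~l ; ρ~w₁ = ρ~w₁ ; ρ~w₃ = Adj-sym w₃~ρ ; w₃~w₄ = Adj-sym w₄~w₃
  ; w₀-leaf = l-leaf
  ; no-leaf-near-w₄ = λ w₄~r r~y y-leaf →
      contradiction (far (step w₄~r (step r~y here)) y-leaf) λ { (s≤s (s≤s ())) }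
  }
  where
  open GraphTheory T
  far : ∀ {y k} → Walk T w₄ y k → Leaf T y → 4 ≤ k
  far {y} {k} w₄⇝y y-leaf =
    +-cancelˡ-≤ (h ∸ 4) 4 k (subst (_≤ h ∸ 4 + k) (sym (m∸n+n≡m 4≤h)) (nearest y _ y-leaf (walk-++ v⇝w₄ w₄⇝y)))

module Construction (T : Graph) (connected : Connected T) (acyclic : Acyclic T)
                    (red : Vertex T → Bool) (proper : ProperColoring T red) (leaves-blue : LeavesBlue T red)
                    (S : Spine T) where
  open Spine S
  open GraphTheory T
  open Colouring T red proper
  open RootedTree T connected acyclic red proper ρ

  private
    V = Vertex T

  w₁-red : red w₁ ≡ true
  w₁-red = trans (colour-flip (Adj-sym w₁~w₀)) (cong not (leaves-blue w₀ w₀-leaf))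

  ρ-blue : red ρ ≡ false
  ρ-blue = trans (colour-flip (Adj-sym ρ~w₁)) (cong not w₁-red)

  w₄-blue : red w₄ ≡ false
  w₄-blue = trans (colour-flip w₃~w₄) (cong not (trans (colour-flip ρ~w₃) (cong not ρ-blue)))

  red⇒Child : ∀ {x} → red x ≡ true → ∃ (Child x)
  red⇒Child {x} x-red = ¬Leaf⇒Child (λ { refl → contradiction (trans (sym x-red) ρ-blue) λ () })
                                    (λ leaf → contradiction (trans (sym x-red) (leaves-blue x leaf)) λ ())

  w₁≢w₃ : w₁ ≢ w₃
  w₁≢w₃ refl = no-leaf-near-w₄ (Adj-sym w₃~w₄) w₁~w₀ w₀-leaf

  w₀≢w₄ : w₀ ≢ w₄
  w₀≢w₄ refl = no-leaf-near-w₄ (Adj-sym w₃~w₄) w₃~w₄ w₀-leaf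

  ρ⋖w₁ : Child ρ w₁
  ρ⋖w₁ = Adj-ρ⇒Child ρ~w₁

  ρ⋖w₃ : Child ρ w₃
  ρ⋖w₃ = Adj-ρ⇒Child ρ~w₃

  w₁⋖w₀ : Child w₁ w₀
  w₁⋖w₀ with Adj⇒Child w₁~w₀
  ... | inj₁ c = c
  ... | inj₂ c with Child-unique c ρ⋖w₁
  ...   | refl = contradiction (leaf-neighbour-unique w₀-leaf ρ~w₁ ρ~w₃) w₁≢w₃

  w₃⋖w₄ : Child w₃ w₄
  w₃⋖w₄ with Adj⇒Child w₃~w₄
  ... | inj₁ c = c
  ... | inj₂ c with Child-unique c ρ⋖w₃
  ...   | refl = contradiction w₀-leaf (no-leaf-near-w₄ ρ~w₁ w₁~w₀)

  Grandchild : V → V → Set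
  Grandchild x z = ∃[ r ] Child x r × Child r z

  Grandchild? : ∀ x z → Dec (Grandchild x z)
  Grandchild? x z = Fin.any? (λ r → Child? x r ×-dec Child? r z)

  -- Left out of the base set, so that the grandchildren of w₄ keep their children as private neighbours.
  Deep : V → Set
  Deep x = ∃[ z ] Grandchild w₄ z × Grandchild z x

  Deep? : ∀ x → Dec (Deep x)
  Deep? x = Fin.any? (λ z → Grandchild? w₄ z ×-dec Grandchild? z x)

  depth-w₁ : depth w₁ ≡ 1
  depth-w₁ = trans (proj₂ ρ⋖w₁) (cong suc depth-ρ)

  depth-w₀ : depth w₀ ≡ 2
  depth-w₀ = trans (proj₂ w₁⋖w₀) (cong suc depth-w₁)

  depth-w₃ : depth w₃ ≡ 1
  depth-w₃ = trans (proj₂ ρ⋖w₃) (cong suc depth-ρ)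

  depth-w₄ : depth w₄ ≡ 2
  depth-w₄ = trans (proj₂ w₃⋖w₄) (cong suc depth-w₃)

  depth-Grandchild : ∀ {x z} → Grandchild x z → depth z ≡ 2 + depth x
  depth-Grandchild (r , (_ , dr) , (_ , dz)) = trans dz (cong suc dr)

  depth-w₄-Grandchild : ∀ {z} → Grandchild w₄ z → depth z ≡ 4
  depth-w₄-Grandchild g = trans (depth-Grandchild g) (cong (2 +_) depth-w₄)

  depth-Deep : ∀ {x} → Deep x → depth x ≡ 6
  depth-Deep (z , g , g′) = trans (depth-Grandchild g′) (cong (2 +_) (depth-w₄-Grandchild g))

  record Candidate (x : V) : Set where
    constructor candidate
    field
      blue : red x ≡ false
      non-root : x ≢ ρ
      w₀-only : Child w₁ x → x ≡ w₀
      w₄-only : Child w₃ x → x ≡ w₄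
      not-deep : ¬ Deep x

  Candidate? : ∀ x → Dec (Candidate x)
  Candidate? x = map′ (λ (b , r , c₁ , c₃ , d) → candidate b r c₁ c₃ d)
                      (λ (candidate b r c₁ c₃ d) → b , r , c₁ , c₃ , d)
                      ((red x Bool.≟ false) ×-dec ¬? (x Fin.≟ ρ) ×-dec (Child? w₁ x →-dec (x Fin.≟ w₀))
                        ×-dec (Child? w₃ x →-dec (x Fin.≟ w₄)) ×-dec ¬? (Deep? x))

  Anchor : V → Set
  Anchor x = x ≡ w₀ ⊎ x ≡ w₄ ⊎ Grandchild w₄ x

  Anchor? : ∀ x → Dec (Anchor x)
  Anchor? x = (x Fin.≟ w₀) ⊎-dec (x Fin.≟ w₄) ⊎-dec Grandchild? w₄ x

  B₀ F : Subset (n T)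
  B₀ = subsetOf Candidate?
  F = subsetOf Anchor?

  Anchor⇒Candidate : ∀ {x} → Anchor x → Candidate x
  Anchor⇒Candidate (inj₁ refl) = candidate
    (leaves-blue w₀ w₀-leaf)
    (λ { refl → contradiction (trans (sym depth-w₀) depth-ρ) λ () })
    (λ _ → refl)
    (λ w₃⋖w₀ → contradiction (Child-unique w₁⋖w₀ w₃⋖w₀) w₁≢w₃)
    (λ deep → contradiction (trans (sym (depth-Deep deep)) depth-w₀) λ ())
  Anchor⇒Candidate (inj₂ (inj₁ refl)) = candidate
    w₄-blue
    (λ { refl → contradiction (trans (sym depth-w₄) depth-ρ) λ () })
    (λ w₁⋖w₄ → contradiction (Child-unique w₁⋖w₄ w₃⋖w₄) w₁≢w₃)
    (λ _ → refl)
    (λ deep → contradiction (trans (sym (depth-Deep deep)) depth-w₄) λ ())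
  Anchor⇒Candidate (inj₂ (inj₂ g@(r , w₄⋖r , r⋖z))) = candidate
    (trans (colour-flip (proj₁ r⋖z)) (cong not (trans (colour-flip (proj₁ w₄⋖r)) (cong not w₄-blue))))
    (λ { refl → ¬Child-ρ r⋖z })
    (λ w₁⋖z → contradiction (trans (sym (depth-w₄-Grandchild g)) (trans (proj₂ w₁⋖z) (cong suc depth-w₁))) λ ())
    (λ w₃⋖z → contradiction (trans (sym (depth-w₄-Grandchild g)) (trans (proj₂ w₃⋖z) (cong suc depth-w₃))) λ ())
    (λ deep → contradiction (trans (sym (depth-Deep deep)) (depth-w₄-Grandchild g)) λ ())

  private-parent : ∀ {p c} → Child ρ p → Child p c → (∀ {x} → Candidate x → Child p x → x ≡ c) → Private B₀ c p
  private-parent ρ⋖p p⋖c only-c = Adj-sym (proj₁ p⋖c) , λ u u∈B₀ u~p → neighbour (∈-subsetOf⁻ Candidate? u∈B₀) u~p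
    where
    neighbour : ∀ {u} → Candidate u → Adj T u _ → u ≡ _
    neighbour cand u~p with Adj⇒Child u~p
    ... | inj₁ u⋖p = contradiction (Child-unique u⋖p ρ⋖p) (Candidate.non-root cand)
    ... | inj₂ p⋖u = only-c cand p⋖u

  Anchor-private : ∀ {x} → Anchor x → ∃ (Private B₀ x)
  Anchor-private (inj₁ refl) = w₁ , private-parent ρ⋖w₁ w₁⋖w₀ Candidate.w₀-only
  Anchor-private (inj₂ (inj₁ refl)) = w₃ , private-parent ρ⋖w₃ w₃⋖w₄ Candidate.w₄-only
  Anchor-private {z} (inj₂ (inj₂ g@(r , w₄⋖r , r⋖z)))
    with ¬Leaf⇒Child (λ { refl → ¬Child-ρ r⋖z }) (no-leaf-near-w₄ (proj₁ w₄⋖r) (proj₁ r⋖z))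
  ... | y , z⋖y = y , proj₁ z⋖y , λ u u∈B₀ u~y → neighbour (∈-subsetOf⁻ Candidate? u∈B₀) u~y
    where
    neighbour : ∀ {u} → Candidate u → Adj T u y → u ≡ z
    neighbour cand u~y with Adj⇒Child u~y
    ... | inj₁ u⋖y = Child-unique u⋖y z⋖y
    ... | inj₂ y⋖u = contradiction (z , g , y , z⋖y , y⋖u) (Candidate.not-deep cand)

  B₀-dominates : ∀ v → red v ≡ true → InN T B₀ v
  B₀-dominates v v-red with v Fin.≟ w₁ | v Fin.≟ w₃
  ... | yes refl | _ = w₀ , ∈-subsetOf⁺ Candidate? (Anchor⇒Candidate (inj₁ refl)) , Adj-sym w₁~w₀
  ... | no _ | yes refl = w₄ , ∈-subsetOf⁺ Candidate? (Anchor⇒Candidate (inj₂ (inj₁ refl))) , Adj-sym w₃~w₄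
  ... | no v≢w₁ | no v≢w₃ with red⇒Child v-red
  ...   | y , v⋖y with Deep? y
  ...     | yes (z , g , m , z⋖m , m⋖y) with Child-unique m⋖y v⋖y
  ...       | refl = z , ∈-subsetOf⁺ Candidate? (Anchor⇒Candidate (inj₂ (inj₂ g))) , proj₁ z⋖m
  B₀-dominates v v-red | no v≢w₁ | no v≢w₃ | y , v⋖y | no shallow =
    y , ∈-subsetOf⁺ Candidate? y-candidate , Adj-sym (proj₁ v⋖y)
    where
    y-candidate : Candidate y
    y-candidate = candidate
      (trans (colour-flip (proj₁ v⋖y)) (cong not v-red))
      (λ { refl → ¬Child-ρ v⋖y })
      (λ w₁⋖y → contradiction (Child-unique v⋖y w₁⋖y) v≢w₁)
      (λ w₃⋖y → contradiction (Child-unique v⋖y w₃⋖y) v≢w₃)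
      shallow

  opaque
    pruning : Pruning F B₀
    pruning = irredundant-core F B₀ (λ x∈F → ∈-subsetOf⁺ Candidate? (Anchor⇒Candidate (∈-subsetOf⁻ Anchor? x∈F)))
                                   (λ x∈F → Anchor-private (∈-subsetOf⁻ Anchor? x∈F))

  open Pruning pruning

  DB : Subset (n T)
  DB = pruned

  Anchor⇒∈DB : ∀ {x} → Anchor x → x ∈ DB
  Anchor⇒∈DB a = keeps (∈-subsetOf⁺ Anchor? a)

  ∈DB⇒Candidate : ∀ {x} → x ∈ DB → Candidate x
  ∈DB⇒Candidate x∈DB = ∈-subsetOf⁻ Candidate? (within x∈DB)

  DB-cover : Cover true DB
  DB-cover = (λ x∈DB → Candidate.blue (∈DB⇒Candidate x∈DB))
           , (λ v v-red → Equivalence.from (same-neighbourhood v) (B₀-dominates v v-red))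
           , irredundant

  Kept : V → Set
  Kept u = ∃[ v ] Private DB u v × ¬ Adj T ρ v

  Kept? : ∀ u → Dec (Kept u)
  Kept? u = Fin.any? (λ v → Private? DB u v ×-dec ¬? (Adj? ρ v))

  DA : Subset (n T)
  DA = ⁅ ρ ⁆ ∪ (DB ∩ subsetOf Kept?)

  ¬Kept-w₀ : ¬ Kept w₀
  ¬Kept-w₀ (v , (w₀~v , _) , ¬ρ~v) with leaf-neighbour-unique w₀-leaf w₀~v (Adj-sym w₁~w₀)
  ... | refl = ¬ρ~v ρ~w₁

  -- Each child of w₄ is red, so it has a child, and that grandchild of w₄ is an anchor in DB.
  ¬Kept-w₄ : ¬ Kept w₄
  ¬Kept-w₄ (v , (w₄~v , only-w₄) , ¬ρ~v) with Adj⇒Child w₄~v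
  ... | inj₂ v⋖w₄ with Child-unique v⋖w₄ w₃⋖w₄
  ...   | refl = ¬ρ~v ρ~w₃
  ¬Kept-w₄ (v , (w₄~v , only-w₄) , ¬ρ~v) | inj₁ w₄⋖v with red⇒Child (trans (colour-flip w₄~v) (cong not w₄-blue))
  ... | z , v⋖z = contradiction (trans (sym (depth-w₄-Grandchild g)) (trans (cong depth z≡w₄) depth-w₄)) λ ()
    where
    g : Grandchild w₄ z
    g = v , w₄⋖v , v⋖z
    z≡w₄ : z ≡ w₄
    z≡w₄ = only-w₄ z (Anchor⇒∈DB (inj₂ (inj₂ g))) (Adj-sym (proj₁ v⋖z))

  private
    K : Subset (n T)
    K = DB ∩ subsetOf Kept?

    ∈K⁻ : ∀ {x} → x ∈ K → x ∈ DB × Kept x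
    ∈K⁻ x∈K = let x∈DB , x∈Kept = x∈p∩q⁻ DB _ x∈K in x∈DB , ∈-subsetOf⁻ Kept? x∈Kept

    ∈DA⁺ : ∀ {x} → x ∈ DB → Kept x → x ∈ DA
    ∈DA⁺ x∈DB kept = x∈p∪q⁺ (inj₂ (x∈p∩q⁺ (x∈DB , ∈-subsetOf⁺ Kept? kept)))

    ∈DA⁻ : ∀ {x} → x ∈ DA → x ≡ ρ ⊎ (x ∈ DB × Kept x)
    ∈DA⁻ x∈DA with x∈p∪q⁻ ⁅ ρ ⁆ K x∈DA
    ... | inj₁ x∈ρ = inj₁ (x∈⁅y⁆⇒x≡y ρ x∈ρ)
    ... | inj₂ x∈K = inj₂ (∈K⁻ x∈K)

  -- A private neighbour of c is v or a child of c, and neither is adjacent to ρ.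
  Child-Kept : ∀ {v c} → ¬ Adj T ρ v → Child v c → c ∈ DB → Kept c
  Child-Kept {v} {c} ¬ρ~v v⋖c c∈DB with irredundant c∈DB
  ... | v′ , p = v′ , p , ¬ρ~v′
    where
    ¬ρ~v′ : ¬ Adj T ρ v′
    ¬ρ~v′ ρ~v′ with Adj⇒Child (proj₁ p)
    ... | inj₁ c⋖v′ with Child-unique c⋖v′ (Adj-ρ⇒Child ρ~v′)
    ...   | refl = ¬Child-ρ v⋖c
    ¬ρ~v′ ρ~v′ | inj₂ v′⋖c with Child-unique v′⋖c v⋖c
    ...   | refl = ¬ρ~v ρ~v′

  -- v is not private to u, so it has a second neighbour in DB, and at most one of the two is its parent.
  DB-child : ∀ {u v} → ¬ Adj T ρ v → u ∈ DB → Adj T u v → ¬ Kept u → ∃[ c ] c ∈ DB × Child v c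
  DB-child {u} {v} ¬ρ~v u∈DB u~v ¬kept with Adj⇒Child u~v | rival u~v (λ p → ¬kept (v , p , ¬ρ~v))
  ... | inj₂ v⋖u | _ = u , u∈DB , v⋖u
  ... | inj₁ u⋖v | u′ , u′∈DB , u′~v , u′≢u with Adj⇒Child u′~v
  ...   | inj₁ u′⋖v = contradiction (Child-unique u′⋖v u⋖v) u′≢u
  ...   | inj₂ v⋖u′ = u′ , u′∈DB , v⋖u′

  DA-dominates : ∀ v → red v ≡ true → InN T DA v
  DA-dominates v v-red with Adj? ρ v | proj₁ (proj₂ DB-cover) v v-red
  ... | yes ρ~v | _ = ρ , x∈p∪q⁺ (inj₁ (x∈⁅x⁆ ρ)) , ρ~v
  ... | no ¬ρ~v | u , u∈DB , u~v with Kept? u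
  ...   | yes kept = u , ∈DA⁺ u∈DB kept , u~v
  ...   | no ¬kept with DB-child ¬ρ~v u∈DB u~v ¬kept
  ...     | c , c∈DB , v⋖c = c , ∈DA⁺ c∈DB (Child-Kept ¬ρ~v v⋖c c∈DB) , Adj-sym (proj₁ v⋖c)

  DA-irredundant : Irredundant DA
  DA-irredundant x∈DA with ∈DA⁻ x∈DA
  ... | inj₁ refl = w₁ , ρ~w₁ , only-ρ
    where
    only-ρ : ∀ u → u ∈ DA → Adj T u w₁ → u ≡ ρ
    only-ρ u u∈DA u~w₁ with ∈DA⁻ u∈DA | Adj⇒Child u~w₁
    ... | inj₁ u≡ρ | _ = u≡ρ
    ... | inj₂ _ | inj₁ u⋖w₁ = Child-unique u⋖w₁ ρ⋖w₁
    ... | inj₂ (u∈DB , kept) | inj₂ w₁⋖u with Candidate.w₀-only (∈DB⇒Candidate u∈DB) w₁⋖u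
    ...   | refl = contradiction kept ¬Kept-w₀
  ... | inj₂ (x∈DB , v , p , ¬ρ~v) = v , private-transfer p only-DB
    where
    only-DB : ∀ {u} → u ∈ DA → Adj T u v → u ∈ DB
    only-DB u∈DA u~v with ∈DA⁻ u∈DA
    ... | inj₁ refl = contradiction u~v ¬ρ~v
    ... | inj₂ (u∈DB , _) = u∈DB

  DA-cover : Cover true DA
  DA-cover = colour , DA-dominates , DA-irredundant
    where
    colour : ∀ {x} → x ∈ DA → red x ≡ false
    colour x∈DA with ∈DA⁻ x∈DA
    ... | inj₁ refl = ρ-blue
    ... | inj₂ (x∈DB , _) = Candidate.blue (∈DB⇒Candidate x∈DB)

  ∣DA∣<∣DB∣ : ∣ DA ∣ < ∣ DB ∣
  ∣DA∣<∣DB∣ = subst (_< ∣ DB ∣) (sym ∣DA∣≡1+∣K∣)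
    (1+∣q∣<∣p∣ (p∩q⊆p DB _) (Anchor⇒∈DB (inj₁ refl)) (Anchor⇒∈DB (inj₂ (inj₁ refl))) w₀≢w₄
               (λ w₀∈K → ¬Kept-w₀ (proj₂ (∈K⁻ w₀∈K))) (λ w₄∈K → ¬Kept-w₄ (proj₂ (∈K⁻ w₄∈K))))
    where
    ∣DA∣≡1+∣K∣ : ∣ DA ∣ ≡ suc ∣ K ∣
    ∣DA∣≡1+∣K∣ = trans (∣p∪q∣≡∣p∣+∣q∣ ⁅ ρ ⁆ K ρ∉K) (cong (_+ ∣ K ∣) (∣⁅x⁆∣≡1 ρ))
      where
      ρ∉K : ∀ {x} → x ∈ ⁅ ρ ⁆ → x ∉ K
      ρ∉K x∈ρ x∈K with x∈⁅y⁆⇒x≡y ρ x∈ρ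
      ... | refl = Candidate.non-root (∈DB⇒Candidate (proj₁ (∈K⁻ x∈K))) refl

  has-neighbour : ∀ v → ∃ (Adj T v)
  has-neighbour v with v Fin.≟ ρ
  ... | yes refl = w₁ , ρ~w₁
  ... | no v≢ρ = let p , p⋖v = parent v≢ρ in p , Adj-sym (proj₁ p⋖v)

theorem4p8 : (T : Graph) → IsTree T → Balanced T
    → (red : Vertex T → Bool) → ProperColoring T red → LeavesBlue T red
    → HeightAtLeast T 4
    → (∃[ D₁ ] ∃[ D₂ ] (IsMinimalRDS T red D₁ × IsMinimalRDS T red D₂ × ∣ D₁ ∣ ≢ ∣ D₂ ∣))
      × ¬ WellTotallyDominated T
theorem4p8 T (connected , acyclic) _ red proper leaves-blue tall =
  (DA , DB , Cover⇒MinimalRDS DA-cover , Cover⇒MinimalRDS DB-cover , sizes) ,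
  Cover-sizes⇒¬WellTotallyDominated DA-cover DB-cover (proj₂ (blue-cover has-neighbour)) sizes
  where
  open Colouring T red proper
  open Construction T connected acyclic red proper leaves-blue (spine tall)
  sizes : ∣ DA ∣ ≢ ∣ DB ∣
  sizes = <⇒≢ ∣DA∣<∣DB∣
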